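{- Let $G=(V,E)$ be a finite simple graph and let $\Sigma_G$ be the following family of constraints on subsets $Y\subseteq E$: (type 1) for every set $\{\alpha,\beta,\gamma\}\subseteq E$ of three edges forming a triangle, $Y$ must satisfy $|Y\cap\{\alpha,\beta,\gamma\}|\ge 2\Rightarrow \{\alpha,\beta,\gamma\}\subseteq Y$; (type 2) for every pair of edges $\alpha=\{a,b\},\beta=\{b,c\}$ with $a\neq c$ and $\{a,c\}\notin E$ (i.e. $(a,b,c)$ is a chordless path), $Y$ must satisfy $|Y\cap\{\alpha,\beta\}|\le 1$. Call $Y$ $\Sigma_G$-closed if it satisfies all these constraints. Then: (a) If $\Pi$ is a Cli-Pac of $G$, then $E(\Pi)$ is $\Sigma_G$-closed. (b) If $Y\subseteq E$ is any $\Sigma_G$-closed set, then the vertex sets of the connected components of the graph $(V,Y)$ form a Cli-Pac $\Pi$ of $G$ with $E(\Pi)=Y$.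
   Context: A Cli-Pac (clique packing) of $G$ is a partition $\Pi=\{V_1,\dots,V_k\}$ of $V$ such that each part $V_i$ is a clique of $G$ (singleton parts allowed). For such $\Pi$, $E(\Pi)$ is the set of all edges of $G$ that have both endpoints in the same part $V_i$. -}

module Defs where

open import Level using (0ℓ)
open import Data.Nat using (ℕ)
open import Data.Fin using (Fin)
open import Data.Product using (Σ; ∃; _×_; _,_)
open import Data.Sum using (_⊎_)
open import Relation.Nullary using (¬_)
import Relation.Nullary.Decidable
import Data.Fin
open import Relation.Binary using (Rel; Symmetric; Irreflexive; Decidable)
open import Relation.Binary.PropositionalEquality using (_≡_; _≢_)
open import Relation.Binary.Construct.Closure.ReflexiveTransitive using (Star)

-- A finite simple graph on the vertex set V = Fin n:
-- a symmetric, irreflexive, decidable adjacency relation.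
-- An edge {a,b} of G is represented by the (unordered) adjacent pair a ~ b.
record Graph (n : ℕ) : Set₁ where
  field
    Adj   : Rel (Fin n) 0ℓ
    sym   : Symmetric Adj
    irr   : Irreflexive _≡_ Adj
    adj?  : Decidable Adj
open Graph public

-- A set of edges Y ⊆ E, given as a symmetric relation on vertices
-- contained in the adjacency relation (Y a b means {a,b} ∈ Y).
record EdgeSet {n : ℕ} (G : Graph n) : Set₁ where
  field
    In    : Rel (Fin n) 0ℓ
    sym   : Symmetric In
    sub   : ∀ {a b} → In a b → Adj G a b
    in?   : Decidable In
open EdgeSet public

AtLeastTwo : Set → Set → Set → Set
AtLeastTwo P Q R = (P × Q) ⊎ (Q × R) ⊎ (P × R)

record ΣClosed {n : ℕ} (G : Graph n) (Y : EdgeSet G) : Set where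
  field
    type1 : ∀ a b c → Adj G a b → Adj G b c → Adj G a c →
            AtLeastTwo (In Y a b) (In Y b c) (In Y a c) →
            In Y a b × In Y b c × In Y a c
    type2 : ∀ a b c → Adj G a b → Adj G b c → a ≢ c → ¬ Adj G a c →
            ¬ (In Y a b × In Y b c)
open ΣClosed public

-- A Cli-Pac Π = {V_1,…,V_k}: a labelling of vertices by k part indices,
-- every index used (parts are nonempty), each part V_i = part⁻¹(i) a clique.
record CliPac {n : ℕ} (G : Graph n) : Set where
  field
    k      : ℕ
    part   : Fin n → Fin k
    onto   : ∀ (i : Fin k) → ∃ λ v → part v ≡ i
    clique : ∀ a b → part a ≡ part b → a ≢ b → Adj G a b
open CliPac public

EΠ : ∀ {n} {G : Graph n} → CliPac G → EdgeSet G
EΠ {G = G} Π = record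
  { In  = λ a b → Adj G a b × part Π a ≡ part Π b
  ; sym = λ { (e , p) → Graph.sym G e , Relation.Binary.PropositionalEquality.sym p }
  ; sub = λ { (e , _) → e }
  ; in? = λ a b → Relation.Nullary.Decidable._×-dec_ (adj? G a b) (Data.Fin._≟_ (part Π a) (part Π b))
  }

Connected : ∀ {n} {G : Graph n} → EdgeSet G → Rel (Fin n) 0ℓ
Connected Y = Star (In Y)

_≐_ : ∀ {n} {G : Graph n} → EdgeSet G → EdgeSet G → Set
Y ≐ Z = ∀ a b → (In Y a b → In Z a b) × (In Z a b → In Y a b)

{-# OPTIONS --safe #-}
-- Σ_G-closedness of Y says precisely that "equal or joined by a Y-edge" is
-- transitive: if ab, bc ∈ Y and a ≠ c, then ac ∈ E (otherwise a-b-c is a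
-- chordless path, violating type 2) and so ac ∈ Y by type 1.  Hence the
-- reflexive closure of Y is a decidable equivalence relation; it coincides with
-- connectivity in (V, Y), and two distinct vertices in one class are joined by a
-- Y-edge, so the classes are cliques spanning exactly Y.  A decidable
-- equivalence on Fin n is the kernel of a surjection onto some Fin k, which is
-- the required Cli-Pac.
module Submission where

open import Level using (Level)
open import Data.Nat using (ℕ; zero; suc)
open import Data.Fin using (Fin; zero; suc; _≟_)
open import Data.Fin.Properties using (any?; suc-injective)
open import Data.Product using (Σ; ∃; _×_; _,_; proj₂)
open import Data.Sum using (inj₁; inj₂)
open import Data.Empty using (⊥-elim)
open import Function using (_on_)
open import Relation.Nullary using (yes; no; ¬_)
open import Relation.Binary using (Rel; Transitive; IsDecEquivalence)
import Relation.Binary.Construct.On as On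
open import Relation.Binary.Construct.Closure.Reflexive using (ReflClosure; [_]; refl)
import Relation.Binary.Construct.Closure.Reflexive.Properties as ReflClosure
open import Relation.Binary.Construct.Closure.ReflexiveTransitive using (ε; _◅_; fold)
open import Relation.Binary.PropositionalEquality as ≡ using (_≡_; _≢_; refl; cong)

open import Defs

record Classification {ℓ : Level} {n : ℕ} (_≈_ : Rel (Fin n) ℓ) : Set ℓ where
  field
    #classes   : ℕ
    class      : Fin n → Fin #classes
    class-onto : ∀ i → ∃ λ v → class v ≡ i
    class-≡⇒≈  : ∀ {a b} → class a ≡ class b → a ≈ b
    ≈⇒class-≡  : ∀ {a b} → a ≈ b → class a ≡ class b

module _ {ℓ : Level} {n : ℕ} {_≈_ : Rel (Fin (suc n)) ℓ}
         (isDecEquivalence : IsDecEquivalence _≈_)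
         (C : Classification (_≈_ on suc)) where

  open IsDecEquivalence isDecEquivalence
    using () renaming (refl to ≈-refl; sym to ≈-sym; trans to ≈-trans)
  open Classification C

  joinClass : ∃ (λ i → zero ≈ suc i) → Classification _≈_
  joinClass (i , 0≈i) = record
    { #classes   = #classes
    ; class      = λ v → class (rep v)
    ; class-onto = λ j → let v , eq = class-onto j in suc v , eq
    ; class-≡⇒≈  = λ {a} {b} eq → ≈-trans (≈rep a) (≈-trans (class-≡⇒≈ eq) (≈-sym (≈rep b)))
    ; ≈⇒class-≡  = λ {a} {b} a≈b → ≈⇒class-≡ (≈-trans (≈-sym (≈rep a)) (≈-trans a≈b (≈rep b)))
    }
    where
    rep : Fin (suc n) → Fin n
    rep zero    = i
    rep (suc v) = v

    ≈rep : ∀ v → v ≈ suc (rep v)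
    ≈rep zero    = 0≈i
    ≈rep (suc v) = ≈-refl

  newClass : ¬ ∃ (λ i → zero ≈ suc i) → Classification _≈_
  newClass 0≉ = record
    { #classes   = suc #classes
    ; class      = class′
    ; class-onto = onto′
    ; class-≡⇒≈  = λ {a} {b} → ≡⇒≈ a b
    ; ≈⇒class-≡  = λ {a} {b} → ≈⇒≡ a b
    }
    where
    class′ : Fin (suc n) → Fin (suc #classes)
    class′ zero    = zero
    class′ (suc v) = suc (class v)

    onto′ : ∀ i → ∃ λ v → class′ v ≡ i
    onto′ zero    = zero , ≡.refl
    onto′ (suc i) = let v , eq = class-onto i in suc v , cong suc eq

    ≡⇒≈ : ∀ a b → class′ a ≡ class′ b → a ≈ b
    ≡⇒≈ zero    zero    _  = ≈-refl
    ≡⇒≈ (suc a) (suc b) eq = class-≡⇒≈ (suc-injective eq)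

    ≈⇒≡ : ∀ a b → a ≈ b → class′ a ≡ class′ b
    ≈⇒≡ zero    zero    _   = ≡.refl
    ≈⇒≡ zero    (suc b) a≈b = ⊥-elim (0≉ (b , a≈b))
    ≈⇒≡ (suc a) zero    a≈b = ⊥-elim (0≉ (a , ≈-sym a≈b))
    ≈⇒≡ (suc a) (suc b) a≈b = cong suc (≈⇒class-≡ a≈b)

classify : ∀ {ℓ n} {_≈_ : Rel (Fin n) ℓ} → IsDecEquivalence _≈_ → Classification _≈_
classify {n = zero} _ = record
  { #classes = zero ; class = λ () ; class-onto = λ () ; class-≡⇒≈ = λ { {()} } ; ≈⇒class-≡ = λ { {()} } }
classify {n = suc n} isDecEquivalence
  with any? (λ i → IsDecEquivalence._≟_ isDecEquivalence zero (suc i))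
... | yes 0≈some = joinClass isDecEquivalence (classify (On.isDecEquivalence suc isDecEquivalence)) 0≈some
... | no  0≉all  = newClass  isDecEquivalence (classify (On.isDecEquivalence suc isDecEquivalence)) 0≉all

EΠ-closed : ∀ {n} {G : Graph n} (Π : CliPac G) → ΣClosed G (EΠ Π)
EΠ-closed {G = G} Π = record { type1 = type1′ ; type2 = type2′ }
  where
  type1′ : ∀ a b c → Adj G a b → Adj G b c → Adj G a c →
           AtLeastTwo (In (EΠ Π) a b) (In (EΠ Π) b c) (In (EΠ Π) a c) →
           In (EΠ Π) a b × In (EΠ Π) b c × In (EΠ Π) a c
  type1′ _ _ _ ab bc ac (inj₁ ((_ , a≡b) , (_ , b≡c))) =
    (ab , a≡b) , (bc , b≡c) , (ac , ≡.trans a≡b b≡c)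
  type1′ _ _ _ ab bc ac (inj₂ (inj₁ ((_ , b≡c) , (_ , a≡c)))) =
    (ab , ≡.trans a≡c (≡.sym b≡c)) , (bc , b≡c) , (ac , a≡c)
  type1′ _ _ _ ab bc ac (inj₂ (inj₂ ((_ , a≡b) , (_ , a≡c)))) =
    (ab , a≡b) , (bc , ≡.trans (≡.sym a≡b) a≡c) , (ac , a≡c)

  type2′ : ∀ a b c → Adj G a b → Adj G b c → a ≢ c → ¬ Adj G a c →
           ¬ (In (EΠ Π) a b × In (EΠ Π) b c)
  type2′ a _ c _ _ a≢c ¬ac ((_ , a≡b) , (_ , b≡c)) = ¬ac (clique Π a c (≡.trans a≡b b≡c) a≢c)

module _ {n : ℕ} {G : Graph n} {Y : EdgeSet G} (closed : ΣClosed G Y) where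

  In-trans : ∀ {a b c} → In Y a b → In Y b c → a ≢ c → In Y a c
  In-trans {a} {b} {c} ab bc a≢c with adj? G a c
  ... | yes ac = proj₂ (proj₂ (type1 closed a b c (sub Y ab) (sub Y bc) ac (inj₁ (ab , bc))))
  ... | no ¬ac = ⊥-elim (type2 closed a b c (sub Y ab) (sub Y bc) a≢c ¬ac (ab , bc))

  ReflClosure-trans : Transitive (ReflClosure (In Y))
  ReflClosure-trans refl     bc       = bc
  ReflClosure-trans [ ab ]   refl     = [ ab ]
  ReflClosure-trans {a} {_} {c} [ ab ] [ bc ] with a ≟ c
  ... | yes refl = refl
  ... | no  a≢c  = [ In-trans ab bc a≢c ]

  ReflClosure-isDecEquivalence : IsDecEquivalence (ReflClosure (In Y))
  ReflClosure-isDecEquivalence = record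
    { isEquivalence = record
      { refl  = refl
      ; sym   = ReflClosure.sym (EdgeSet.sym Y)
      ; trans = ReflClosure-trans
      }
    ; _≟_ = ReflClosure.dec _≟_ (in? Y)
    }

  Connected⇒ReflClosure : ∀ {a b} → Connected Y a b → ReflClosure (In Y) a b
  Connected⇒ReflClosure = fold (ReflClosure (In Y)) (λ ab → ReflClosure-trans [ ab ]) refl

  ReflClosure⇒Connected : ∀ {a b} → ReflClosure (In Y) a b → Connected Y a b
  ReflClosure⇒Connected refl   = ε
  ReflClosure⇒Connected [ ab ] = ab ◅ ε

  private
    module Components = Classification (classify ReflClosure-isDecEquivalence)

  edge-within : ∀ {a b} → Components.class a ≡ Components.class b → a ≢ b → In Y a b
  edge-within eq a≢b with Components.class-≡⇒≈ eq
  ... | refl   = ⊥-elim (a≢b refl)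
  ... | [ ab ] = ab

  components : CliPac G
  components = record
    { k      = Components.#classes
    ; part   = Components.class
    ; onto   = Components.class-onto
    ; clique = λ a b eq a≢b → sub Y (edge-within eq a≢b)
    }

  components-connected : ∀ a b → (part components a ≡ part components b → Connected Y a b)
                               × (Connected Y a b → part components a ≡ part components b)
  components-connected a b =
      (λ eq → ReflClosure⇒Connected (Components.class-≡⇒≈ eq))
    , (λ ab → Components.≈⇒class-≡ (Connected⇒ReflClosure ab))

  E-components : EΠ components ≐ Y
  E-components a b =
      (λ (ab , eq) → edge-within eq (λ a≡b → irr G a≡b ab))
    , (λ ab → sub Y ab , Components.≈⇒class-≡ [ ab ])

lemma8 : ∀ {n : ℕ} (G : Graph n) →
           ((Π : CliPac G) → ΣClosed G (EΠ Π))
         × ((Y : EdgeSet G) → ΣClosed G Y →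
             Σ (CliPac G) λ Π →
               (∀ a b → (part Π a ≡ part Π b → Connected Y a b)
                      × (Connected Y a b → part Π a ≡ part Π b))
               × (EΠ Π ≐ Y))
lemma8 G = EΠ-closed , λ Y closed → components closed , components-connected closed , E-components closed
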